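{- Consider the commutative algebra of Laurent polynomials in the variables $a,b,u_1,u_2,u_3,u_4$ with coefficients in $\mathbb{Q}[\alpha,\beta]$, and let $D$ be the unique derivation of this algebra (i.e. $D$ is linear, satisfies $D(fg)=D(f)g+fD(g)$, and kills $\mathbb{Q}[\alpha,\beta]$) with $$D(a)=\alpha a u_4,\quad D(b)=\beta b u_3,\quad D(u_4)=u_1u_2,\quad D(u_3)=u_1u_2,\quad D(u_1)=u_1u_3,\quad D(u_2)=u_2u_4.$$ Then for every $n\ge0$, $$D^n(ab)=ab\,P_n(u_1,u_2,u_3,u_4\mid\alpha,\beta).$$
   Context: $\mathfrak S_m$ is the set of permutations $\sigma=\sigma_1\cdots\sigma_m$ of $[m]$. ${\rm V}(\sigma)$ = number of $1<i<m$ with $\sigma_{i-1}>\sigma_i<\sigma_{i+1}$; ${\rm W}(\sigma)$ = number of $1\le i\le m$ with $\sigma_{i-1}<\sigma_i>\sigma_{i+1}$ where $\sigma_0=\sigma_{m+1}=0$; ${\rm rdd}(\sigma)$ = number of $1<i\le m$ with $\sigma_{i-1}>\sigma_i>\sigma_{i+1}$ where $\sigma_{m+1}=0$; ${\rm lda}(\sigma)$ = number of $1\le i<m$ with $\sigma_{i-1}<\sigma_i<\sigma_{i+1}$ where $\sigma_0=0$; ${\rm LRmax}(\sigma)$, ${\rm RLmax}(\sigma)$ = numbers of left-to-right and right-to-left maxima. $P_n(u_1,u_2,u_3,u_4\mid\alpha,\beta)=\sum_{\sigma\in\mathfrak S_{n+1}}u_1^{{\rm V}(\sigma)}u_2^{{\rm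 W}(\sigma)-1}u_3^{{\rm rdd}(\sigma)}u_4^{{\rm lda}(\sigma)}\alpha^{{\rm LRmax}(\sigma)-1}\beta^{{\rm RLmax}(\sigma)-1}$. -}

module Defs where

open import Data.Nat as ℕ using (ℕ; zero; suc; _∸_; _<ᵇ_)
open import Data.Integer as ℤ using (ℤ; +_; 0ℤ; 1ℤ)
open import Data.Bool using (Bool; true; false; _∧_; if_then_else_)
open import Data.List using (List; []; _∷_; map; concatMap; _++_; foldr; reverse; length; filter)
open import Data.Vec as Vec using (Vec; []; _∷_; zipWith; lookup; tabulate)
open import Data.Vec.Properties using () renaming (≡-dec to vec≡-dec)
open import Data.Fin using (Fin; zero; suc)
open import Data.Fin.Properties using () renaming (_≟_ to _≟F_)
open import Data.Product using (_×_; _,_; proj₁; proj₂)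
open import Relation.Nullary using (yes; no; Dec)
open import Relation.Nullary.Decidable using (⌊_⌋)
open import Relation.Binary.PropositionalEquality using (_≡_)

-- Laurent polynomials in a, b, u₁, u₂, u₃, u₄ over ℤ[α, β]
-- (coefficients ℤ — ℤ[α,β][a^±,…] ⊆ ℚ[α,β][a^±,…]).
--
-- A monomial: integer exponent vector for the Laurent variables,
-- indexed  0 ↦ a, 1 ↦ b, 2 ↦ u₁, 3 ↦ u₂, 4 ↦ u₃, 5 ↦ u₄,
-- together with natural exponents of α and β.

Mono : Set
Mono = Vec ℤ 6 × ℕ × ℕ

_≟M_ : (m m' : Mono) → Dec (m ≡ m')
(e , i , j) ≟M (e' , i' , j') with vec≡-dec ℤ._≟_ e e' | i ℕ.≟ i' | j ℕ.≟ j'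
... | yes Relation.Binary.PropositionalEquality.refl | yes Relation.Binary.PropositionalEquality.refl | yes Relation.Binary.PropositionalEquality.refl = yes Relation.Binary.PropositionalEquality.refl
... | no p | _ | _ = no λ { Relation.Binary.PropositionalEquality.refl → p Relation.Binary.PropositionalEquality.refl }
... | yes _ | no p | _ = no λ { Relation.Binary.PropositionalEquality.refl → p Relation.Binary.PropositionalEquality.refl }
... | yes _ | yes _ | no p = no λ { Relation.Binary.PropositionalEquality.refl → p Relation.Binary.PropositionalEquality.refl }

-- A polynomial is a finite formal sum of terms (coefficient, monomial);
-- two polynomials are equal iff their coefficient functions agree.
Poly : Set
Poly = List (ℤ × Mono)

coeff : Poly → Mono → ℤ
coeff [] m = 0ℤ
coeff ((c , m') ∷ p) m with ⌊ m' ≟M m ⌋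
... | true  = c ℤ.+ coeff p m
... | false = coeff p m

_≈P_ : Poly → Poly → Set
p ≈P q = ∀ m → coeff p m ≡ coeff q m

monoMul : Mono → Mono → Mono
monoMul (e , i , j) (e' , i' , j') = zipWith ℤ._+_ e e' , i ℕ.+ i' , j ℕ.+ j'

_*P_ : Poly → Poly → Poly
p *P q = concatMap (λ { (c , m) → map (λ { (c' , m') → (c ℤ.* c' , monoMul m m') }) q }) p

zeroVec : Vec ℤ 6
zeroVec = tabulate (λ _ → 0ℤ)

δ : Fin 6 → Vec ℤ 6
δ k = tabulate (λ l → if ⌊ k ≟F l ⌋ then 1ℤ else 0ℤ)

var : Fin 6 → Poly
var k = (1ℤ , δ k , 0 , 0) ∷ []

α : Poly
α = (1ℤ , zeroVec , 1 , 0) ∷ []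

β : Poly
β = (1ℤ , zeroVec , 0 , 1) ∷ []

a b u₁ u₂ u₃ u₄ : Poly
a = var zero
b = var (suc zero)
u₁ = var (suc (suc zero))
u₂ = var (suc (suc (suc zero)))
u₃ = var (suc (suc (suc (suc zero))))
u₄ = var (suc (suc (suc (suc (suc zero)))))

Dgen : Fin 6 → Poly
Dgen zero = α *P (a *P u₄)
Dgen (suc zero) = β *P (b *P u₃)
Dgen (suc (suc zero)) = u₁ *P u₃
Dgen (suc (suc (suc zero))) = u₂ *P u₄
Dgen (suc (suc (suc (suc zero)))) = u₁ *P u₂
Dgen (suc (suc (suc (suc (suc zero))))) = u₁ *P u₂

allFin6 : List (Fin 6)
allFin6 = zero ∷ suc zero ∷ suc (suc zero) ∷ suc (suc (suc zero))
  ∷ suc (suc (suc (suc zero))) ∷ suc (suc (suc (suc (suc zero)))) ∷ []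

-- The unique ℚ[α,β]-linear derivation with the prescribed values, given
-- by the Leibniz rule on monomials:
--   D(c α^i β^j x^e) = Σ_k c e_k α^i β^j x^(e - δ_k) D(x_k).
Dterm : ℤ × Mono → Poly
Dterm (c , e , i , j) =
  concatMap (λ k → ((c ℤ.* lookup e k , zipWith ℤ._-_ e (δ k) , i , j) ∷ []) *P Dgen k) allFin6

D : Poly → Poly
D = concatMap Dterm

iter : (Poly → Poly) → ℕ → Poly → Poly
iter f zero p = p
iter f (suc n) p = f (iter f n p)

insertions : ℕ → List ℕ → List (List ℕ)
insertions x [] = (x ∷ []) ∷ []
insertions x (y ∷ ys) = (x ∷ y ∷ ys) ∷ map (y ∷_) (insertions x ys)

perms : ℕ → List (List ℕ)
perms zero = [] ∷ []
perms (suc m) = concatMap (insertions (suc m)) (perms m)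

triples : List ℕ → List (ℕ × ℕ × ℕ)
triples (x ∷ y ∷ z ∷ rest) = (x , y , z) ∷ triples (y ∷ z ∷ rest)
triples _ = []

padTriples : List ℕ → List (ℕ × ℕ × ℕ)
padTriples σ = triples (0 ∷ σ ++ (0 ∷ []))

countT : (ℕ → ℕ → ℕ → Bool) → List ℕ → ℕ
countT P σ = length (filter (λ { (x , y , z) → Dec-of (P x y z) }) (padTriples σ))
  where
  open import Data.Bool.Properties using (T?)
  open import Data.Bool using (T)
  Dec-of : (q : Bool) → Dec (T q)
  Dec-of q = T? q

-- Padding with σ₀ = σ_{m+1} = 0 never creates a spurious occurrence
-- (values of σ are ≥ 1), so these agree with the index ranges in the paper.
V W rdd lda : List ℕ → ℕ
V   = countT (λ x y z → (y <ᵇ x) ∧ (y <ᵇ z))   -- σ_{i-1} > σ_i < σ_{i+1}, 1<i<m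
W   = countT (λ x y z → (x <ᵇ y) ∧ (z <ᵇ y))   -- σ_{i-1} < σ_i > σ_{i+1}, 1≤i≤m
rdd = countT (λ x y z → (y <ᵇ x) ∧ (z <ᵇ y))   -- σ_{i-1} > σ_i > σ_{i+1}, 1<i≤m
lda = countT (λ x y z → (x <ᵇ y) ∧ (y <ᵇ z))   -- σ_{i-1} < σ_i < σ_{i+1}, 1≤i<m

LRmaxAux : ℕ → List ℕ → ℕ
LRmaxAux cur [] = 0
LRmaxAux cur (x ∷ xs) = if cur <ᵇ x then suc (LRmaxAux x xs) else LRmaxAux cur xs

LRmax RLmax : List ℕ → ℕ
LRmax σ = LRmaxAux 0 σ
RLmax σ = LRmax (reverse σ)

weight : List ℕ → ℤ × Mono
weight σ = 1ℤ , (0ℤ ∷ 0ℤ ∷ + V σ ∷ + (W σ ∸ 1) ∷ + rdd σ ∷ + lda σ ∷ []) ,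
                LRmax σ ∸ 1 , RLmax σ ∸ 1

P : ℕ → Poly
P n = map weight (perms (suc n))

-- Write a b P_n as the sum over σ ∈ 𝔖_{n+1} of a b u₁^V u₂^(W-1) u₃^rdd u₄^lda α^(LRmax-1) β^(RLmax-1).
-- By the Leibniz rule, D multiplies such a monomial by α u₄ + β u₃ + V u₃ + V u₄ + rdd u₁u₂/u₃ + lda u₁u₂/u₄
-- (using W - 1 = V). Inserting 1 into the n+2 gaps of σ shifted up by one produces exactly these factors:
-- the first gap adds a double ascent and a left-to-right maximum, the last gap a double descent and a
-- right-to-left maximum, and the interior gaps, grouped by the triple of σ they disturb, give u₃ and u₄
-- for each valley, u₁u₂/u₃ for each double descent and u₁u₂/u₄ for each double ascent. Every permutation
-- of [n+2] arises exactly once by inserting 1 into a permutation of [n+1], so D(a b P_n) = a b P_{n+1}.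
-- Polynomials are compared coefficientwise, so D must also be shown to respect that equality.

module Submission where

open import Defs
open import Data.Nat as ℕ using (ℕ; zero; suc; _≤_; z≤n; s≤s; _∸_; _<ᵇ_)
import Data.Nat.Properties as ℕP
open import Data.Integer using (ℤ; +_; 0ℤ; 1ℤ; _+_; _*_; -_; _-_)
import Data.Integer.Properties as ℤP
open import Data.Integer.Tactic.RingSolver using (solve-∀)
open import Data.Bool using (Bool; true; false; if_then_else_; _∧_; not)
open import Data.Bool.Properties using (T?)
open import Data.List using (List; []; _∷_; [_]; _++_; _∷ʳ_; map; replicate; length; filter; concatMap; reverse)
open import Data.List.Relation.Binary.Permutation.Propositional
  using (_↭_; refl; prep; swap; trans; ↭-refl; ↭-prep; ↭-swap; ↭-trans; ↭-sym; ↭-reflexive; module PermutationReasoning)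
import Data.List.Relation.Binary.Permutation.Propositional.Properties as ↭P
open import Data.Vec using (_∷_; []; lookup; zipWith)
open import Data.Fin using (Fin; zero; suc)
import Data.List.Properties as LP
open import Data.Product using (_×_; _,_)
open import Relation.Unary using (Pred; Decidable)
open import Function using (_∘_)
open import Relation.Binary.Bundles using (Setoid)
import Relation.Binary.Reasoning.Setoid
open import Relation.Nullary using (yes; no; does)
open import Relation.Nullary.Decidable using (⌊_⌋)
open import Relation.Binary.PropositionalEquality as ≡ using (_≡_; _≢_; refl; cong; cong₂; sym)
open import Data.Empty using (⊥-elim)
open import Data.List.Relation.Unary.All as All using (All; []; _∷_)
import Data.List.Relation.Unary.All.Properties as AllP
open import Data.List.Relation.Unary.Linked as Linked using (Linked; []; [-]; _∷_)
import Data.List.Relation.Unary.Linked.Properties as LinkedP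
open import Algebra.Properties.CommutativeSemigroup ℤP.+-commutativeSemigroup using (x∙yz≈y∙xz)

≈P-setoid : Setoid _ _
≈P-setoid = record
  { Carrier = Poly
  ; _≈_ = _≈P_
  ; isEquivalence = record
    { refl = λ _ → refl
    ; sym = λ p≈q m → sym (p≈q m)
    ; trans = λ p≈q q≈r m → ≡.trans (p≈q m) (q≈r m)
    }
  }

module ≈P-Reasoning = Relation.Binary.Reasoning.Setoid ≈P-setoid

coeff-++ : ∀ p q m → coeff (p ++ q) m ≡ coeff p m + coeff q m
coeff-++ [] q m = sym (ℤP.+-identityˡ _)
coeff-++ ((c , m′) ∷ p) q m with ⌊ m′ ≟M m ⌋
... | true = ≡.trans (cong (_+_ c) (coeff-++ p q m)) (sym (ℤP.+-assoc c _ _))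
... | false = coeff-++ p q m

++-cong : ∀ {p p′ q q′} → p ≈P p′ → q ≈P q′ → (p ++ q) ≈P (p′ ++ q′)
++-cong {p} {p′} {q} {q′} p≈p′ q≈q′ m = begin
  coeff (p ++ q) m         ≡⟨ coeff-++ p q m ⟩
  coeff p m + coeff q m    ≡⟨ cong₂ _+_ (p≈p′ m) (q≈q′ m) ⟩
  coeff p′ m + coeff q′ m  ≡⟨ sym (coeff-++ p′ q′ m) ⟩
  coeff (p′ ++ q′) m       ∎
  where open ≡.≡-Reasoning

↭⇒≈P : ∀ {p q} → p ↭ q → p ≈P q
↭⇒≈P refl _ = refl
↭⇒≈P (prep {xs} {ys} t p↭q) = ++-cong {[ t ]} {[ t ]} {xs} {ys} (λ _ → refl) (↭⇒≈P p↭q)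
↭⇒≈P (swap {xs} {ys} s t p↭q) = ++-cong {s ∷ t ∷ []} {t ∷ s ∷ []} {xs} {ys} swapped (↭⇒≈P p↭q)
  where
  swapped : (s ∷ t ∷ []) ≈P (t ∷ s ∷ [])
  swapped m = ≡.trans (coeff-++ [ s ] [ t ] m) (≡.trans (ℤP.+-comm (coeff [ s ] m) (coeff [ t ] m)) (sym (coeff-++ [ t ] [ s ] m)))
↭⇒≈P (trans p↭q q↭r) m = ≡.trans (↭⇒≈P p↭q m) (↭⇒≈P q↭r m)

coeff-single : ∀ c M m → coeff [ c , M ] m ≡ c * coeff [ 1ℤ , M ] m
coeff-single c M m with ⌊ M ≟M m ⌋
... | true = ≡.trans (ℤP.+-identityʳ c) (sym (ℤP.*-identityʳ c))
... | false = sym (ℤP.*-zeroʳ c)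

single-+ : ∀ c c′ M → [ c + c′ , M ] ≈P ((c , M) ∷ (c′ , M) ∷ [])
single-+ c c′ M m = begin
  coeff [ c + c′ , M ] m                       ≡⟨ coeff-single (c + c′) M m ⟩
  (c + c′) * k                                 ≡⟨ ℤP.*-distribʳ-+ k c c′ ⟩
  c * k + c′ * k                               ≡⟨ sym (cong₂ _+_ (coeff-single c M m) (coeff-single c′ M m)) ⟩
  coeff [ c , M ] m + coeff [ c′ , M ] m       ≡⟨ sym (coeff-++ [ c , M ] [ c′ , M ] m) ⟩
  coeff ((c , M) ∷ (c′ , M) ∷ []) m            ∎
  where
  open ≡.≡-Reasoning
  k = coeff [ 1ℤ , M ] m

single≈replicate : ∀ n M → [ + n , M ] ≈P replicate n (1ℤ , M)
single≈replicate zero M m = ≡.trans (coeff-single 0ℤ M m) (ℤP.*-zeroˡ (coeff [ 1ℤ , M ] m))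
single≈replicate (suc n) M = begin
  [ 1ℤ + + n , M ]                 ≈⟨ single-+ 1ℤ (+ n) M ⟩
  (1ℤ , M) ∷ [ + n , M ]           ≈⟨ ++-cong {[ 1ℤ , M ]} {[ 1ℤ , M ]} (λ _ → refl) (single≈replicate n M) ⟩
  (1ℤ , M) ∷ replicate n (1ℤ , M)  ∎
  where open ≈P-Reasoning

single≈replicate′ : ∀ {c M} n M′ → c ≡ + n → M ≡ M′ → [ c , M ] ≈P replicate n (1ℤ , M′)
single≈replicate′ n M′ refl refl = single≈replicate n M′

scale : ℤ → Poly → Poly
scale c = map λ { (c′ , m′) → c * c′ , m′ }

coeff-scale : ∀ c p m → coeff (scale c p) m ≡ c * coeff p m
coeff-scale c [] m = sym (ℤP.*-zeroʳ c)
coeff-scale c ((c′ , m′) ∷ p) m with ⌊ m′ ≟M m ⌋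
... | true = ≡.trans (cong (_+_ (c * c′)) (coeff-scale c p m)) (sym (ℤP.*-distribˡ-+ c c′ _))
... | false = coeff-scale c p m

concatMap-cong≈P : ∀ {A : Set} (f g : A → Poly) xs → All (λ x → f x ≈P g x) xs → concatMap f xs ≈P concatMap g xs
concatMap-cong≈P f g [] [] _ = refl
concatMap-cong≈P f g (x ∷ xs) (fx≈gx ∷ rest) = ++-cong {f x} {g x} {concatMap f xs} {concatMap g xs} fx≈gx (concatMap-cong≈P f g xs rest)

-- The derivation respects coefficientwise equality

-- coeff (D p) m is a linear functional of p. A linear functional vanishes on every list of terms whose
-- coefficients are all zero, as is seen by deleting one monomial at a time.

lin : (Mono → ℤ) → Poly → ℤ
lin g [] = 0ℤ
lin g ((c , m) ∷ p) = c * g m + lin g p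

lin-++ : ∀ g p q → lin g (p ++ q) ≡ lin g p + lin g q
lin-++ g [] q = sym (ℤP.+-identityˡ _)
lin-++ g ((c , m) ∷ p) q = ≡.trans (cong (_+_ (c * g m)) (lin-++ g p q)) (sym (ℤP.+-assoc (c * g m) _ _))

lin-scale : ∀ g c p → lin g (scale c p) ≡ c * lin g p
lin-scale g c [] = sym (ℤP.*-zeroʳ c)
lin-scale g c ((c′ , m) ∷ p) = ≡.trans (cong (_+_ (c * c′ * g m)) (lin-scale g c p)) (distrib c c′ (g m) (lin g p))
  where
  distrib : ∀ c c′ x y → c * c′ * x + c * y ≡ c * (c′ * x + y)
  distrib = solve-∀

without : Mono → Poly → Poly
without m₀ [] = []
without m₀ ((c , m) ∷ p) with m ≟M m₀
... | yes _ = without m₀ p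
... | no _ = (c , m) ∷ without m₀ p

lin-without : ∀ g m₀ p → lin g p ≡ coeff p m₀ * g m₀ + lin g (without m₀ p)
lin-without g m₀ [] = refl
lin-without g m₀ ((c , m) ∷ p) with m ≟M m₀
... | yes refl = ≡.trans (cong (_+_ (c * g m)) (lin-without g m p)) (collect c (coeff p m) (g m) _)
  where
  collect : ∀ c c′ x y → c * x + (c′ * x + y) ≡ (c + c′) * x + y
  collect = solve-∀
... | no _ = ≡.trans (cong (_+_ (c * g m)) (lin-without g m₀ p)) (x∙yz≈y∙xz (c * g m) (coeff p m₀ * g m₀) (lin g (without m₀ p)))

coeff-without-self : ∀ m₀ p → coeff (without m₀ p) m₀ ≡ 0ℤ
coeff-without-self m₀ [] = refl
coeff-without-self m₀ ((c , m) ∷ p) with m ≟M m₀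
... | yes _ = coeff-without-self m₀ p
... | no m≢m₀ with m ≟M m₀
...   | yes m≡m₀ = ⊥-elim (m≢m₀ m≡m₀)
...   | no _ = coeff-without-self m₀ p

coeff-without-other : ∀ m₀ p {m} → m ≢ m₀ → coeff (without m₀ p) m ≡ coeff p m
coeff-without-other m₀ [] m≢m₀ = refl
coeff-without-other m₀ ((c , m′) ∷ p) {m} m≢m₀ with m′ ≟M m₀
... | yes refl with m′ ≟M m
...   | yes refl = ⊥-elim (m≢m₀ refl)
...   | no _ = coeff-without-other m₀ p m≢m₀
coeff-without-other m₀ ((c , m′) ∷ p) {m} m≢m₀ | no _ with m′ ≟M m
...   | yes _ = cong (_+_ c) (coeff-without-other m₀ p m≢m₀)
...   | no _ = coeff-without-other m₀ p m≢m₀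

length-without : ∀ m₀ p → length (without m₀ p) ≤ length p
length-without m₀ [] = z≤n
length-without m₀ ((c , m) ∷ p) with m ≟M m₀
... | yes _ = ℕP.m≤n⇒m≤1+n (length-without m₀ p)
... | no _ = s≤s (length-without m₀ p)

without-head : ∀ c m₀ p → without m₀ ((c , m₀) ∷ p) ≡ without m₀ p
without-head c m₀ p with m₀ ≟M m₀
... | yes _ = refl
... | no m₀≢m₀ = ⊥-elim (m₀≢m₀ refl)

without-≈P[] : ∀ m₀ {p} → p ≈P [] → without m₀ p ≈P []
without-≈P[] m₀ {p} p≈[] m with m ≟M m₀
... | yes refl = coeff-without-self m p
... | no m≢m₀ = ≡.trans (coeff-without-other m₀ p m≢m₀) (p≈[] m)

lin-≈P[] : ∀ g n p → length p ≤ n → p ≈P [] → lin g p ≡ 0ℤ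
lin-≈P[] g n [] _ _ = refl
lin-≈P[] g (suc n) p@((c , m₀) ∷ p′) (s≤s |p′|≤n) p≈[] = begin
  lin g p                                     ≡⟨ lin-without g m₀ p ⟩
  coeff p m₀ * g m₀ + lin g (without m₀ p)    ≡⟨ cong₂ (λ x q → x * g m₀ + lin g q) (p≈[] m₀) (without-head c m₀ p′) ⟩
  0ℤ + lin g (without m₀ p′)                  ≡⟨ ℤP.+-identityˡ _ ⟩
  lin g (without m₀ p′)                       ≡⟨ lin-≈P[] g n (without m₀ p′) (ℕP.≤-trans (length-without m₀ p′) |p′|≤n) rest≈[] ⟩
  0ℤ                                          ∎
  where
  open ≡.≡-Reasoning
  rest≈[] : without m₀ p′ ≈P []
  rest≈[] = ≡.subst (_≈P []) (without-head c m₀ p′) (without-≈P[] m₀ {p} p≈[])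

lin-cong : ∀ g {p q} → p ≈P q → lin g p ≡ lin g q
lin-cong g {p} {q} p≈q = difference-zero (begin
  lin g p + - 1ℤ * lin g q           ≡⟨ cong (_+_ (lin g p)) (sym (lin-scale g (- 1ℤ) q)) ⟩
  lin g p + lin g (scale (- 1ℤ) q)   ≡⟨ sym (lin-++ g p _) ⟩
  lin g (p ++ scale (- 1ℤ) q)        ≡⟨ lin-≈P[] g _ (p ++ scale (- 1ℤ) q) ℕP.≤-refl cancels ⟩
  0ℤ                                 ∎)
  where
  open ≡.≡-Reasoning
  cancels : (p ++ scale (- 1ℤ) q) ≈P []
  cancels m = ≡.trans (coeff-++ p _ m) (≡.trans (cong₂ _+_ (p≈q m) (coeff-scale (- 1ℤ) q m)) (x-x (coeff q m)))
    where
    x-x : ∀ x → x + - 1ℤ * x ≡ 0ℤ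
    x-x = solve-∀
  difference-zero : ∀ {x y} → x + - 1ℤ * y ≡ 0ℤ → x ≡ y
  difference-zero {x} {y} x-y≡0 = ≡.trans (rearrange x y) (≡.trans (cong (_+ y) x-y≡0) (ℤP.+-identityˡ y))
    where
    rearrange : ∀ x y → x ≡ (x + - 1ℤ * y) + y
    rearrange = solve-∀

Dterm-scale : ∀ c e i j → Dterm (c , e , i , j) ≡ scale c (Dterm (1ℤ , e , i , j))
Dterm-scale c (e₀ ∷ e₁ ∷ e₂ ∷ e₃ ∷ e₄ ∷ e₅ ∷ []) i j =
  scaled c e₀ ∷-cong scaled c e₁ ∷-cong scaled c e₂ ∷-cong scaled c e₃ ∷-cong scaled c e₄ ∷-cong scaled c e₅ ∷-cong refl
  where
  scaled : ∀ c x → c * x * 1ℤ ≡ c * (1ℤ * x * 1ℤ)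
  scaled = solve-∀
  infixr 5 _∷-cong_
  _∷-cong_ : ∀ {x y : ℤ} {M : Mono} {p q : Poly} → x ≡ y → p ≡ q → (x , M) ∷ p ≡ (y , M) ∷ q
  refl ∷-cong refl = refl

coeff-Dterm : ∀ c m′ m → coeff (Dterm (c , m′)) m ≡ c * coeff (Dterm (1ℤ , m′)) m
coeff-Dterm c (e , i , j) m = ≡.trans (cong (λ p → coeff p m) (Dterm-scale c e i j)) (coeff-scale c (Dterm (1ℤ , e , i , j)) m)

coeff-D : ∀ p m → coeff (D p) m ≡ lin (λ m′ → coeff (Dterm (1ℤ , m′)) m) p
coeff-D [] m = refl
coeff-D ((c , m′) ∷ p) m = ≡.trans (coeff-++ (Dterm (c , m′)) (D p) m) (cong₂ _+_ (coeff-Dterm c m′ m) (coeff-D p m))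

D-cong : ∀ {p q} → p ≈P q → D p ≈P D q
D-cong {p} {q} p≈q m = ≡.trans (coeff-D p m) (≡.trans (lin-cong _ {p} {q} p≈q) (sym (coeff-D q m)))

-- The Leibniz rule on the monomials a b u₁^v u₂^v u₃^r u₄^d α^i β^j

data Stats : Set where
  stats : (valleys doubleDescents doubleAscents : ℤ) → Stats

infixl 6 _⊕_ _⊖_

_⊕_ : Stats → Stats → Stats
stats v r d ⊕ stats v′ r′ d′ = stats (v + v′) (r + r′) (d + d′)

_⊖_ : Stats → Stats → Stats
stats v r d ⊖ stats v′ r′ d′ = stats (v - v′) (r - r′) (d - d′)

stats-cong : ∀ {v r d v′ r′ d′} → v ≡ v′ → r ≡ r′ → d ≡ d′ → stats v r d ≡ stats v′ r′ d′
stats-cong refl refl refl = refl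

stats-injective : ∀ {v r d v′ r′ d′} → stats v r d ≡ stats v′ r′ d′ → v ≡ v′ × r ≡ r′ × d ≡ d′
stats-injective refl = refl , refl , refl

⊕-assoc : ∀ A B C → (A ⊕ B) ⊕ C ≡ A ⊕ (B ⊕ C)
⊕-assoc (stats a b c) (stats a′ b′ c′) (stats a″ b″ c″) = stats-cong (ℤP.+-assoc a a′ a″) (ℤP.+-assoc b b′ b″) (ℤP.+-assoc c c′ c″)

⊕-comm : ∀ A B → A ⊕ B ≡ B ⊕ A
⊕-comm (stats a b c) (stats a′ b′ c′) = stats-cong (ℤP.+-comm a a′) (ℤP.+-comm b b′) (ℤP.+-comm c c′)

⊕-regroup : ∀ A B C P Q R → A ⊕ (B ⊕ (C ⊕ R)) ≡ (P ⊕ (Q ⊕ R)) ⊕ (A ⊕ B ⊕ C ⊖ P ⊖ Q)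
⊕-regroup (stats a₁ a₂ a₃) (stats b₁ b₂ b₃) (stats c₁ c₂ c₃) (stats p₁ p₂ p₃) (stats q₁ q₂ q₃) (stats r₁ r₂ r₃) =
  stats-cong (regroup a₁ b₁ c₁ p₁ q₁ r₁) (regroup a₂ b₂ c₂ p₂ q₂ r₂) (regroup a₃ b₃ c₃ p₃ q₃ r₃)
  where
  regroup : ∀ a b c p q r → a + (b + (c + r)) ≡ (p + (q + r)) + (a + b + c - p - q)
  regroup = solve-∀

-- The exponent changes of the Leibniz terms: D b and D u₁ multiply by u₃, D a and D u₂ by u₄,
-- D u₃ by u₁u₂/u₃ and D u₄ by u₁u₂/u₄.

rdd⁺ lda⁺ rdd⇒V lda⇒V : Stats
rdd⁺ = stats 0ℤ 1ℤ 0ℤ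
lda⁺ = stats 0ℤ 0ℤ 1ℤ
rdd⇒V = stats 1ℤ (- 1ℤ) 0ℤ
lda⇒V = stats 1ℤ 0ℤ (- 1ℤ)

interiorSteps : ℕ → ℕ → ℕ → List Stats
interiorSteps v r d = replicate v rdd⁺ ++ replicate v lda⁺ ++ replicate r rdd⇒V ++ replicate d lda⇒V

map-interiorSteps : ∀ {A : Set} (f : Stats → A) v r d → map f (interiorSteps v r d) ≡
  replicate v (f rdd⁺) ++ replicate v (f lda⁺) ++ replicate r (f rdd⇒V) ++ replicate d (f lda⇒V) ++ []
map-interiorSteps f v r d =
  ≡.trans (LP.map-++ f (replicate v rdd⁺) _) (cong₂ _++_ (LP.map-replicate f v rdd⁺)
  (≡.trans (LP.map-++ f (replicate v lda⁺) _) (cong₂ _++_ (LP.map-replicate f v lda⁺)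
  (≡.trans (LP.map-++ f (replicate r rdd⇒V) _) (cong₂ _++_ (LP.map-replicate f r rdd⇒V)
  (≡.trans (LP.map-replicate f d lda⇒V) (sym (LP.++-identityʳ _))))))))

Item : Set
Item = Stats × ℕ × ℕ

insertionItems : Stats → ℕ → ℕ → List Stats → List Item
insertionItems S L R X = (S ⊕ lda⁺ , suc L , R) ∷ (S ⊕ rdd⁺ , L , suc R) ∷ map (λ δ → S ⊕ δ , L , R) X

-- u₂ carries the exponent V, since W - 1 = V on permutations (W≡suc-V).
term : Item → ℤ × Mono
term (stats v r d , L , R) = 1ℤ , (1ℤ ∷ 1ℤ ∷ v ∷ v ∷ r ∷ d ∷ []) , L ∸ 1 , R ∸ 1

mono-cong : ∀ {a b e₂ e₃ e₄ e₅ f₂ f₃ f₄ f₅ : ℤ} {i j i′ j′ : ℕ} →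
  e₂ ≡ f₂ → e₃ ≡ f₃ → e₄ ≡ f₄ → e₅ ≡ f₅ → i ≡ i′ → j ≡ j′ →
  _≡_ {A = Mono} ((a ∷ b ∷ e₂ ∷ e₃ ∷ e₄ ∷ e₅ ∷ []) , i , j) ((a ∷ b ∷ f₂ ∷ f₃ ∷ f₄ ∷ f₅ ∷ []) , i′ , j′)
mono-cong refl refl refl refl refl refl = refl

Dterm-term : ∀ v r d i j → let S = stats (+ v) (+ r) (+ d) in
  Dterm (term (S , suc i , suc j)) ≈P map term (insertionItems S (suc i) (suc j) (interiorSteps v r d))
Dterm-term v r d i j = begin
  Dterm (term (S , suc i , suc j))        ≈⟨ concatMap-cong≈P (Dpiece (term (S , suc i , suc j))) leibniz allFin6 pieces ⟩
  concatMap leibniz allFin6               ≡⟨ sym concat-leibniz ⟩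
  map term (insertionItems S (suc i) (suc j) (interiorSteps v r d)) ∎
  where
  open ≈P-Reasoning
  S = stats (+ v) (+ r) (+ d)
  Dpiece : ℤ × Mono → Fin 6 → Poly
  Dpiece (c , e , i′ , j′) k = [ c * lookup e k , zipWith _-_ e (δ k) , i′ , j′ ] *P Dgen k
  inner : Stats → Item
  inner δ = S ⊕ δ , suc i , suc j
  leibniz : Fin 6 → Poly
  leibniz zero = [ term (S ⊕ lda⁺ , suc (suc i) , suc j) ]
  leibniz (suc zero) = [ term (S ⊕ rdd⁺ , suc i , suc (suc j)) ]
  leibniz (suc (suc zero)) = replicate v (term (inner rdd⁺))
  leibniz (suc (suc (suc zero))) = replicate v (term (inner lda⁺))
  leibniz (suc (suc (suc (suc zero)))) = replicate r (term (inner rdd⇒V))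
  leibniz (suc (suc (suc (suc (suc zero))))) = replicate d (term (inner lda⇒V))
  concat-leibniz : map term (insertionItems S (suc i) (suc j) (interiorSteps v r d)) ≡ concatMap leibniz allFin6
  concat-leibniz = cong (λ ts → term (S ⊕ lda⁺ , suc (suc i) , suc j) ∷ term (S ⊕ rdd⁺ , suc i , suc (suc j)) ∷ ts)
    (≡.trans (sym (LP.map-∘ (interiorSteps v r d))) (map-interiorSteps (term ∘ inner) v r d))
  u-shift : ∀ x s g → x - s + g ≡ x + (g - s)
  u-shift = solve-∀
  unit-coefficient : ∀ x → 1ℤ * x * 1ℤ ≡ x
  unit-coefficient = solve-∀
  -- one row per generator a, b, u₁, …, u₄: in row k an exponent x becomes x - s + g, where s is
  -- 1 at the k-th generator and 0 elsewhere, and g is the exponent in Dgen k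
  pieces : All (λ k → Dpiece (term (S , suc i , suc j)) k ≈P leibniz k) allFin6
  pieces =
      single≈replicate′ 1 _ refl (mono-cong (u-shift (+ v) 0ℤ 0ℤ) (u-shift (+ v) 0ℤ 0ℤ) (u-shift (+ r) 0ℤ 0ℤ) (u-shift (+ d) 0ℤ 1ℤ) (ℕP.+-comm i 1) (ℕP.+-identityʳ j))
    ∷ single≈replicate′ 1 _ refl (mono-cong (u-shift (+ v) 0ℤ 0ℤ) (u-shift (+ v) 0ℤ 0ℤ) (u-shift (+ r) 0ℤ 1ℤ) (u-shift (+ d) 0ℤ 0ℤ) (ℕP.+-identityʳ i) (ℕP.+-comm j 1))
    ∷ single≈replicate′ v _ (unit-coefficient (+ v)) (mono-cong (u-shift (+ v) 1ℤ 1ℤ) (u-shift (+ v) 0ℤ 0ℤ) (u-shift (+ r) 0ℤ 1ℤ) (u-shift (+ d) 0ℤ 0ℤ) (ℕP.+-identityʳ i) (ℕP.+-identityʳ j))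
    ∷ single≈replicate′ v _ (unit-coefficient (+ v)) (mono-cong (u-shift (+ v) 0ℤ 0ℤ) (u-shift (+ v) 1ℤ 1ℤ) (u-shift (+ r) 0ℤ 0ℤ) (u-shift (+ d) 0ℤ 1ℤ) (ℕP.+-identityʳ i) (ℕP.+-identityʳ j))
    ∷ single≈replicate′ r _ (unit-coefficient (+ r)) (mono-cong (u-shift (+ v) 0ℤ 1ℤ) (u-shift (+ v) 0ℤ 1ℤ) (u-shift (+ r) 1ℤ 0ℤ) (u-shift (+ d) 0ℤ 0ℤ) (ℕP.+-identityʳ i) (ℕP.+-identityʳ j))
    ∷ single≈replicate′ d _ (unit-coefficient (+ d)) (mono-cong (u-shift (+ v) 0ℤ 1ℤ) (u-shift (+ v) 0ℤ 1ℤ) (u-shift (+ r) 0ℤ 0ℤ) (u-shift (+ d) 1ℤ 0ℤ) (ℕP.+-identityʳ i) (ℕP.+-identityʳ j))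
    ∷ []

-- Generating permutations by inserting the minimum

module _ {A B : Set} where

  concatMap-↭ : ∀ (f : A → List B) {xs ys} → xs ↭ ys → concatMap f xs ↭ concatMap f ys
  concatMap-↭ f refl = ↭-refl
  concatMap-↭ f (prep x xs↭ys) = ↭P.++⁺ˡ (f x) (concatMap-↭ f xs↭ys)
  concatMap-↭ f (swap {xs} {ys} x y xs↭ys) = begin
    f x ++ f y ++ concatMap f xs     ≡⟨ sym (LP.++-assoc (f x) (f y) _) ⟩
    (f x ++ f y) ++ concatMap f xs   ↭⟨ ↭P.++⁺ (↭P.++-comm (f x) (f y)) (concatMap-↭ f xs↭ys) ⟩
    (f y ++ f x) ++ concatMap f ys   ≡⟨ LP.++-assoc (f y) (f x) _ ⟩
    f y ++ f x ++ concatMap f ys     ∎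
    where open PermutationReasoning
  concatMap-↭ f (trans xs↭ys ys↭zs) = ↭-trans (concatMap-↭ f xs↭ys) (concatMap-↭ f ys↭zs)

  concatMap-↭-pointwise : ∀ {f g : A → List B} → (∀ x → f x ↭ g x) → ∀ xs → concatMap f xs ↭ concatMap g xs
  concatMap-↭-pointwise f↭g [] = ↭-refl
  concatMap-↭-pointwise f↭g (x ∷ xs) = ↭P.++⁺ (f↭g x) (concatMap-↭-pointwise f↭g xs)

concatMap-++-↭ : ∀ {A B : Set} (f g : A → List B) xs → concatMap (λ x → f x ++ g x) xs ↭ concatMap f xs ++ concatMap g xs
concatMap-++-↭ f g [] = ↭-refl
concatMap-++-↭ f g (x ∷ xs) = begin
  (f x ++ g x) ++ concatMap (λ x → f x ++ g x) xs   ≡⟨ LP.++-assoc (f x) (g x) _ ⟩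
  f x ++ g x ++ concatMap (λ x → f x ++ g x) xs     ↭⟨ ↭P.++⁺ˡ (f x) (↭P.++⁺ˡ (g x) (concatMap-++-↭ f g xs)) ⟩
  f x ++ g x ++ concatMap f xs ++ concatMap g xs    ↭⟨ ↭P.++⁺ˡ (f x) (↭P.shifts (g x) (concatMap f xs)) ⟩
  f x ++ concatMap f xs ++ g x ++ concatMap g xs    ≡⟨ sym (LP.++-assoc (f x) (concatMap f xs) _) ⟩
  (f x ++ concatMap f xs) ++ g x ++ concatMap g xs  ∎
  where open PermutationReasoning

concatMap-concatMap : ∀ {A B C : Set} (f : B → List C) (g : A → List B) xs →
                      concatMap f (concatMap g xs) ≡ concatMap (concatMap f ∘ g) xs
concatMap-concatMap f g [] = refl
concatMap-concatMap f g (x ∷ xs) = ≡.trans (LP.concatMap-++ f (g x) (concatMap g xs)) (cong (concatMap f (g x) ++_) (concatMap-concatMap f g xs))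

map-suc-insertions : ∀ x σ → map (map suc) (insertions x σ) ≡ insertions (suc x) (map suc σ)
map-suc-insertions x [] = refl
map-suc-insertions x (y ∷ ys) = cong ((suc x ∷ suc y ∷ map suc ys) ∷_) (begin
  map (map suc) (map (y ∷_) (insertions x ys))           ≡⟨ sym (LP.map-∘ (insertions x ys)) ⟩
  map (λ τ → suc y ∷ map suc τ) (insertions x ys)        ≡⟨ LP.map-∘ (insertions x ys) ⟩
  map (suc y ∷_) (map (map suc) (insertions x ys))       ≡⟨ cong (map (suc y ∷_)) (map-suc-insertions x ys) ⟩
  map (suc y ∷_) (insertions (suc x) (map suc ys))       ∎)
  where open ≡.≡-Reasoning

concatMap-insertions-∷ : ∀ x z (L : List (List ℕ)) →
  concatMap (insertions x) (map (z ∷_) L) ↭ map (λ w → x ∷ z ∷ w) L ++ map (z ∷_) (concatMap (insertions x) L)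
concatMap-insertions-∷ x z [] = ↭-refl
concatMap-insertions-∷ x z (w ∷ L) = ↭-prep (x ∷ z ∷ w) (begin
  map (z ∷_) (insertions x w) ++ concatMap (insertions x) (map (z ∷_) L)
    ↭⟨ ↭P.++⁺ˡ (map (z ∷_) (insertions x w)) (concatMap-insertions-∷ x z L) ⟩
  map (z ∷_) (insertions x w) ++ map (λ w → x ∷ z ∷ w) L ++ map (z ∷_) (concatMap (insertions x) L)
    ↭⟨ ↭P.shifts (map (z ∷_) (insertions x w)) (map (λ w → x ∷ z ∷ w) L) ⟩
  map (λ w → x ∷ z ∷ w) L ++ map (z ∷_) (insertions x w) ++ map (z ∷_) (concatMap (insertions x) L)
    ≡⟨ cong (map (λ w → x ∷ z ∷ w) L ++_) (sym (LP.map-++ (z ∷_) (insertions x w) _)) ⟩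
  map (λ w → x ∷ z ∷ w) L ++ map (z ∷_) (concatMap (insertions x) (w ∷ L)) ∎)
  where open PermutationReasoning

insertions-comm : ∀ x y τ → concatMap (insertions x) (insertions y τ) ↭ concatMap (insertions y) (insertions x τ)
insertions-comm x y [] = ↭-swap (x ∷ y ∷ []) (y ∷ x ∷ []) ↭-refl
insertions-comm x y (z ∷ zs) = begin
  concatMap (insertions x) (insertions y (z ∷ zs))
    ↭⟨ expand x y ⟩
  (x ∷ y ∷ z ∷ zs) ∷ (y ∷ x ∷ z ∷ zs) ∷ (under y x ++ under x y ++ map (z ∷_) (concatMap (insertions x) (insertions y zs)))
    ↭⟨ ↭-swap _ _ (↭P.shifts (under y x) (under x y)) ⟩
  (y ∷ x ∷ z ∷ zs) ∷ (x ∷ y ∷ z ∷ zs) ∷ (under x y ++ under y x ++ map (z ∷_) (concatMap (insertions x) (insertions y zs)))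
    ↭⟨ ↭-prep _ (↭-prep _ (↭P.++⁺ˡ (under x y) (↭P.++⁺ˡ (under y x) (↭P.map⁺ (z ∷_) (insertions-comm x y zs))))) ⟩
  (y ∷ x ∷ z ∷ zs) ∷ (x ∷ y ∷ z ∷ zs) ∷ (under x y ++ under y x ++ map (z ∷_) (concatMap (insertions y) (insertions x zs)))
    ↭⟨ ↭-sym (expand y x) ⟩
  concatMap (insertions y) (insertions x (z ∷ zs)) ∎
  where
  open PermutationReasoning
  under : ℕ → ℕ → List (List ℕ)
  under u v = map (λ w → u ∷ z ∷ w) (insertions v zs)
  expand : ∀ u v → concatMap (insertions u) (insertions v (z ∷ zs)) ↭
    (u ∷ v ∷ z ∷ zs) ∷ (v ∷ u ∷ z ∷ zs) ∷ (under v u ++ under u v ++ map (z ∷_) (concatMap (insertions u) (insertions v zs)))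
  expand u v = ↭-prep _ (↭-prep _ (↭P.++⁺ (↭-reflexive (sym (LP.map-∘ (insertions u zs)))) (concatMap-insertions-∷ u z (insertions v zs))))

-- perms builds 𝔖ₖ₊₁ by inserting the maximum, whereas D corresponds to inserting the minimum.
insertOne : List ℕ → List (List ℕ)
insertOne σ = insertions 1 (map suc σ)

perms-insertOne : ∀ k → concatMap insertOne (perms k) ↭ perms (suc k)
perms-insertOne zero = ↭-refl
perms-insertOne (suc k) = begin
  concatMap insertOne (concatMap (insertions (suc k)) (perms k))
    ≡⟨ concatMap-concatMap insertOne (insertions (suc k)) (perms k) ⟩
  concatMap (concatMap insertOne ∘ insertions (suc k)) (perms k)
    ↭⟨ concatMap-↭-pointwise insert-commutes (perms k) ⟩
  concatMap (concatMap (insertions (suc (suc k))) ∘ insertOne) (perms k)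
    ≡⟨ sym (concatMap-concatMap (insertions (suc (suc k))) insertOne (perms k)) ⟩
  concatMap (insertions (suc (suc k))) (concatMap insertOne (perms k))
    ↭⟨ concatMap-↭ (insertions (suc (suc k))) (perms-insertOne k) ⟩
  concatMap (insertions (suc (suc k))) (perms (suc k)) ∎
  where
  open PermutationReasoning
  insert-commutes : ∀ σ → concatMap insertOne (insertions (suc k) σ) ↭ concatMap (insertions (suc (suc k))) (insertOne σ)
  insert-commutes σ = begin
    concatMap (insertions 1 ∘ map suc) (insertions (suc k) σ)   ≡⟨ sym (LP.concatMap-map (insertions 1) (map suc) (insertions (suc k) σ)) ⟩
    concatMap (insertions 1) (map (map suc) (insertions (suc k) σ)) ≡⟨ cong (concatMap (insertions 1)) (map-suc-insertions (suc k) σ) ⟩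
    concatMap (insertions 1) (insertions (suc (suc k)) (map suc σ)) ↭⟨ insertions-comm 1 (suc (suc k)) (map suc σ) ⟩
    concatMap (insertions (suc (suc k))) (insertOne σ) ∎

Shaped : List ℕ → Set
Shaped σ = σ ≢ [] × All (1 ≤_) σ × Linked _≢_ σ

All-insertions : ∀ {P : ℕ → Set} x σ → P x → All P σ → All (All P) (insertions x σ)
All-insertions x [] px [] = (px ∷ []) ∷ []
All-insertions x (y ∷ ys) px (py ∷ pys) = (px ∷ py ∷ pys) ∷ AllP.map⁺ (All.map (py ∷_) (All-insertions x ys px pys))

insertions-nonempty : ∀ x σ → All (_≢ []) (insertions x σ)
insertions-nonempty x [] = (λ ()) ∷ []
insertions-nonempty x (y ∷ ys) = (λ ()) ∷ AllP.map⁺ (All.map (λ _ ()) (insertions-nonempty x ys))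

2≤⇒1≢ : ∀ {y} → 2 ≤ y → 1 ≢ y
2≤⇒1≢ (s≤s ()) refl

Linked-∷-insertions : ∀ y ys → All (2 ≤_) (y ∷ ys) → Linked _≢_ (y ∷ ys) → All (λ τ → Linked _≢_ (y ∷ τ)) (insertions 1 ys)
Linked-∷-insertions y [] (2≤y ∷ []) _ = ((2≤⇒1≢ 2≤y) ∘ sym ∷ [-]) ∷ []
Linked-∷-insertions y (z ∷ zs) (2≤y ∷ 2≤z ∷ 2≤zs) (y≢z ∷ linked) =
  ((2≤⇒1≢ 2≤y) ∘ sym ∷ 2≤⇒1≢ 2≤z ∷ linked) ∷ AllP.map⁺ (All.map (y≢z ∷_) (Linked-∷-insertions z zs (2≤z ∷ 2≤zs) linked))

Linked-insertions : ∀ σ → All (2 ≤_) σ → Linked _≢_ σ → All (Linked _≢_) (insertions 1 σ)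
Linked-insertions [] _ _ = [-] ∷ []
Linked-insertions (y ∷ ys) (2≤y ∷ 2≤ys) linked =
  (2≤⇒1≢ 2≤y ∷ linked) ∷ AllP.map⁺ (Linked-∷-insertions y ys (2≤y ∷ 2≤ys) linked)

All-map-suc : ∀ {k} σ → All (k ≤_) σ → All (suc k ≤_) (map suc σ)
All-map-suc σ k≤σ = AllP.map⁺ (All.map s≤s k≤σ)

Linked-map-suc : ∀ {σ} → Linked _≢_ σ → Linked _≢_ (map suc σ)
Linked-map-suc linked = LinkedP.map⁺ (Linked.map (λ x≢y → x≢y ∘ ℕP.suc-injective) linked)

Shaped-insertOne : ∀ σ → Shaped σ → All Shaped (insertOne σ)
Shaped-insertOne σ (_ , 1≤σ , linked) = All.zip (insertions-nonempty 1 (map suc σ) , All.zip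
  ( All-insertions 1 (map suc σ) ℕP.≤-refl (All.map ℕP.<⇒≤ (All-map-suc σ 1≤σ))
  , Linked-insertions (map suc σ) (All-map-suc σ 1≤σ) (Linked-map-suc linked)))

Shaped-perms : ∀ k → All Shaped (perms (suc k))
Shaped-perms zero = ((λ ()) , (s≤s z≤n ∷ []) , [-]) ∷ []
Shaped-perms (suc k) = ↭P.All-resp-↭ (perms-insertOne (suc k))
  (AllP.concat⁺ (AllP.map⁺ (All.map (Shaped-insertOne _) (Shaped-perms k))))

Triple : Set
Triple = ℕ × ℕ × ℕ

count : (ℕ → ℕ → ℕ → Bool) → List Triple → ℕ
count P [] = 0
count P ((x , y , z) ∷ T) = if P x y z then suc (count P T) else count P T

length-filter≡count : ∀ {p} {Q : Pred Triple p} (Q? : Decidable Q) P → (∀ x y z → does (Q? (x , y , z)) ≡ P x y z) →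
                      ∀ T → length (filter Q? T) ≡ count P T
length-filter≡count Q? P Q?≡P [] = refl
length-filter≡count Q? P Q?≡P ((x , y , z) ∷ T) rewrite sym (Q?≡P x y z) with does (Q? (x , y , z))
... | true = cong suc (length-filter≡count Q? P Q?≡P T)
... | false = length-filter≡count Q? P Q?≡P T

countT≡count : ∀ P σ → countT P σ ≡ count P (padTriples σ)
countT≡count P σ = length-filter≡count _ P (λ x y z → does-T? (P x y z)) (padTriples σ)
  where
  does-T? : ∀ b → does (T? b) ≡ b
  does-T? true = refl
  does-T? false = refl

isValley isPeak isDoubleDescent isDoubleAscent : ℕ → ℕ → ℕ → Bool
isValley x y z = (y <ᵇ x) ∧ (y <ᵇ z)
isPeak x y z = (x <ᵇ y) ∧ (z <ᵇ y)
isDoubleDescent x y z = (y <ᵇ x) ∧ (z <ᵇ y)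
isDoubleAscent x y z = (x <ᵇ y) ∧ (y <ᵇ z)

<ᵇ-flip : ∀ x y → x ≢ y → (y <ᵇ x) ≡ not (x <ᵇ y)
<ᵇ-flip zero zero x≢y = ⊥-elim (x≢y refl)
<ᵇ-flip zero (suc y) _ = refl
<ᵇ-flip (suc x) zero _ = refl
<ᵇ-flip (suc x) (suc y) x≢y = <ᵇ-flip x y (x≢y ∘ cong suc)

fromBool : Bool → ℕ
fromBool true = 1
fromBool false = 0

peak-valley-step : ∀ q r n m → n ≡ m ℕ.+ fromBool r →
  (if q ∧ not r then suc n else n) ≡ (if not q ∧ r then suc m else m) ℕ.+ fromBool q
peak-valley-step true true n m n≡ = n≡
peak-valley-step true false n m n≡ = ≡.trans (cong suc (≡.trans n≡ (ℕP.+-identityʳ m))) (ℕP.+-comm 1 m)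
peak-valley-step false true n m n≡ = ≡.trans n≡ (≡.trans (ℕP.+-comm m 1) (sym (ℕP.+-identityʳ (suc m))))
peak-valley-step false false n m n≡ = n≡

peaks≡valleys+ : ∀ x y ys → x ≢ y → All (1 ≤_) (y ∷ ys) → Linked _≢_ (y ∷ ys) →
  count isPeak (triples (x ∷ y ∷ ys ++ [ 0 ])) ≡ count isValley (triples (x ∷ y ∷ ys ++ [ 0 ])) ℕ.+ fromBool (x <ᵇ y)
peaks≡valleys+ x zero ys _ (() ∷ _) _
peaks≡valleys+ x (suc y) [] x≢y _ _
  rewrite <ᵇ-flip x (suc y) x≢y = peak-valley-step (x <ᵇ suc y) false 0 0 refl
peaks≡valleys+ x (suc y) (z ∷ zs) x≢y (_ ∷ z∷zs≥1) (y≢z ∷ linked)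
  rewrite <ᵇ-flip x (suc y) x≢y | <ᵇ-flip (suc y) z y≢z =
  peak-valley-step (x <ᵇ suc y) (suc y <ᵇ z) _ _ (peaks≡valleys+ (suc y) z zs y≢z z∷zs≥1 linked)

W≡suc-V : ∀ σ → Shaped σ → W σ ≡ suc (V σ)
W≡suc-V [] (σ≢[] , _) = ⊥-elim (σ≢[] refl)
W≡suc-V (zero ∷ _) (_ , () ∷ _ , _)
W≡suc-V σ@(suc y ∷ ys) (_ , 1≤σ , linked) = begin
  W σ                                       ≡⟨ countT≡count isPeak σ ⟩
  count isPeak (padTriples σ)               ≡⟨ peaks≡valleys+ 0 (suc y) ys (λ ()) 1≤σ linked ⟩
  count isValley (padTriples σ) ℕ.+ 1       ≡⟨ ℕP.+-comm _ 1 ⟩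
  suc (count isValley (padTriples σ))       ≡⟨ cong suc (sym (countT≡count isValley σ)) ⟩
  suc (V σ)                                 ∎
  where open ≡.≡-Reasoning

tripleStatsB : Bool → Bool → Bool → Bool → Stats
tripleStatsB a b c d = stats (+ fromBool (a ∧ c)) (+ fromBool (a ∧ d)) (+ fromBool (b ∧ c))

tripleStats : Triple → Stats
tripleStats (x , y , z) = tripleStatsB (y <ᵇ x) (x <ᵇ y) (y <ᵇ z) (z <ᵇ y)

statsOf : List Triple → Stats
statsOf [] = stats 0ℤ 0ℤ 0ℤ
statsOf (t ∷ T) = tripleStats t ⊕ statsOf T

statsOf≡counts : ∀ T → statsOf T ≡ stats (+ count isValley T) (+ count isDoubleDescent T) (+ count isDoubleAscent T)
statsOf≡counts [] = refl
statsOf≡counts ((x , y , z) ∷ T) rewrite statsOf≡counts T =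
  stats-cong (+-fromBool (isValley x y z) _) (+-fromBool (isDoubleDescent x y z) _) (+-fromBool (isDoubleAscent x y z) _)
  where
  +-fromBool : ∀ b n → + fromBool b + + n ≡ + (if b then suc n else n)
  +-fromBool true n = refl
  +-fromBool false n = refl

statsFrom : ℕ → List ℕ → Stats
statsFrom x τ = statsOf (triples (x ∷ τ ++ [ 0 ]))

item : List ℕ → Item
item σ = statsFrom 0 σ , LRmax σ , RLmax σ

statsFrom-suc : ∀ x τ → All (1 ≤_) τ → statsFrom (suc x) (map suc τ) ≡ statsFrom x τ
statsFrom-suc x [] _ = refl
statsFrom-suc x (zero ∷ _) (() ∷ _)
statsFrom-suc x (suc y ∷ []) _ = refl
statsFrom-suc x (suc y ∷ z ∷ zs) (_ ∷ 1≤zzs) = cong (tripleStats (x , suc y , z) ⊕_) (statsFrom-suc (suc y) (z ∷ zs) 1≤zzs)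

statsFrom-0≡1 : ∀ y ys → 2 ≤ y → statsFrom 0 (y ∷ ys) ≡ statsFrom 1 (y ∷ ys)
statsFrom-0≡1 (suc zero) _ (s≤s ())
statsFrom-0≡1 (suc (suc y)) [] _ = refl
statsFrom-0≡1 (suc (suc y)) (z ∷ zs) _ = refl

statsFrom-map-suc : ∀ σ → All (1 ≤_) σ → statsFrom 0 (map suc σ) ≡ statsFrom 0 σ
statsFrom-map-suc [] _ = refl
statsFrom-map-suc (y ∷ ys) 1≤σ@(1≤y ∷ _) =
  ≡.trans (statsFrom-0≡1 (suc y) (map suc ys) (s≤s 1≤y)) (statsFrom-suc 0 (y ∷ ys) 1≤σ)

-- Inserting 1 into a permutation

gapChange : ℕ → ℕ → ℕ → ℕ → Stats
gapChange x y z w = tripleStats (x , y , 1) ⊕ tripleStats (y , 1 , z) ⊕ tripleStats (1 , z , w)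
                    ⊖ tripleStats (x , y , z) ⊖ tripleStats (y , z , w)

head₀ : List ℕ → ℕ
head₀ [] = 0
head₀ (w ∷ _) = w

gapChanges : ℕ → ℕ → List ℕ → List Stats
gapChanges x y [] = [ rdd⁺ ]
gapChanges x y (z ∷ zs) = gapChange x y z (head₀ zs) ∷ gapChanges y z zs

statsFrom-insert-gap : ∀ x y z zs → statsFrom x (y ∷ 1 ∷ z ∷ zs) ≡ statsFrom x (y ∷ z ∷ zs) ⊕ gapChange x y z (head₀ zs)
statsFrom-insert-gap x y z [] =
  ⊕-regroup (tripleStats (x , y , 1)) (tripleStats (y , 1 , z)) (tripleStats (1 , z , 0))
            (tripleStats (x , y , z)) (tripleStats (y , z , 0)) (statsOf [])
statsFrom-insert-gap x y z (w ∷ ws) =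
  ⊕-regroup (tripleStats (x , y , 1)) (tripleStats (y , 1 , z)) (tripleStats (1 , z , w))
            (tripleStats (x , y , z)) (tripleStats (y , z , w)) (statsFrom z (w ∷ ws))

statsFrom-insertions : ∀ x y ys → 2 ≤ y → All (2 ≤_) ys →
  map (λ τ → statsFrom x (y ∷ τ)) (insertions 1 ys) ≡ map (statsFrom x (y ∷ ys) ⊕_) (gapChanges x y ys)
statsFrom-insertions x (suc zero) [] (s≤s ()) []
statsFrom-insertions x (suc (suc y)) [] _ [] = cong [_] (end (tripleStats (x , suc (suc y) , 0)))
  where
  end : ∀ A → A ⊕ (rdd⁺ ⊕ statsOf []) ≡ (A ⊕ statsOf []) ⊕ rdd⁺
  end (stats a b c) = stats-cong (lemma a 0ℤ) (lemma b 1ℤ) (lemma c 0ℤ)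
    where
    lemma : ∀ a e → a + (e + 0ℤ) ≡ a + 0ℤ + e
    lemma = solve-∀
statsFrom-insertions x y (z ∷ zs) 2≤y (2≤z ∷ 2≤zs) = cong₂ _∷_ (statsFrom-insert-gap x y z zs) (begin
  map (λ τ → statsFrom x (y ∷ τ)) (map (z ∷_) (insertions 1 zs))
    ≡⟨ sym (LP.map-∘ (insertions 1 zs)) ⟩
  map (λ τ → statsFrom x (y ∷ z ∷ τ)) (insertions 1 zs)
    ≡⟨ LP.map-∘ (insertions 1 zs) ⟩
  map (tripleStats (x , y , z) ⊕_) (map (λ τ → statsFrom y (z ∷ τ)) (insertions 1 zs))
    ≡⟨ cong (map (tripleStats (x , y , z) ⊕_)) (statsFrom-insertions y z zs 2≤z 2≤zs) ⟩
  map (tripleStats (x , y , z) ⊕_) (map (statsFrom y (z ∷ zs) ⊕_) (gapChanges y z zs))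
    ≡⟨ sym (LP.map-∘ (gapChanges y z zs)) ⟩
  map (λ δ → tripleStats (x , y , z) ⊕ (statsFrom y (z ∷ zs) ⊕ δ)) (gapChanges y z zs)
    ≡⟨ LP.map-cong (λ δ → sym (⊕-assoc (tripleStats (x , y , z)) (statsFrom y (z ∷ zs)) δ)) (gapChanges y z zs) ⟩
  map (statsFrom x (y ∷ z ∷ zs) ⊕_) (gapChanges y z zs) ∎)
  where open ≡.≡-Reasoning

stepIf : (ℕ → ℕ → ℕ → Bool) → Stats → Triple → List Stats
stepIf P δ (x , y , z) = if P x y z then [ δ ] else []

tripleSteps : Triple → List Stats
tripleSteps t = stepIf isValley rdd⁺ t ++ stepIf isValley lda⁺ t ++ stepIf isDoubleDescent rdd⇒V t ++ stepIf isDoubleAscent lda⇒V t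

tripleStepsB : Bool → Bool → Bool → Bool → List Stats
tripleStepsB a b c d = (if a ∧ c then [ rdd⁺ ] else []) ++ (if a ∧ c then [ lda⁺ ] else [])
                       ++ (if a ∧ d then [ rdd⇒V ] else []) ++ (if b ∧ c then [ lda⇒V ] else [])

-- carry x y z is the part of tripleSteps (x , y , z) already produced by the gap before y;
-- with it the changes of the successive gaps telescope.

carryB : Bool → Bool → List Stats
carryB a d = if a then (if d then [ rdd⇒V ] else [ lda⁺ ]) else []

carry : ℕ → ℕ → ℕ → List Stats
carry x y z = carryB (y <ᵇ x) (z <ᵇ y)

carry-stepB : ∀ p q r s t u R → p ≡ not q → s ≡ not r → u ≡ not t →
  carryB p s ++ (tripleStatsB p q false true ⊕ tripleStatsB true false true false ⊕ tripleStatsB false true t u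
                 ⊖ tripleStatsB p q r s ⊖ tripleStatsB s r t u) ∷ R
  ↭ tripleStepsB p q r s ++ carryB s u ++ R
carry-stepB _ true true _ true _ R refl refl refl = ↭-refl
carry-stepB _ true true _ false _ R refl refl refl = ↭-refl
carry-stepB _ true false _ true _ R refl refl refl = ↭-refl
carry-stepB _ true false _ false _ R refl refl refl = ↭-refl
carry-stepB _ false true _ true _ R refl refl refl = ↭-swap _ _ ↭-refl
carry-stepB _ false true _ false _ R refl refl refl = ↭-swap _ _ ↭-refl
carry-stepB _ false false _ true _ R refl refl refl = ↭-refl
carry-stepB _ false false _ false _ R refl refl refl = ↭-refl

carry-endB : ∀ p q → p ≡ not q → carryB p true ++ [ rdd⁺ ] ↭ rdd⁺ ∷ (tripleStepsB p q false true ++ [])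
carry-endB _ true refl = ↭-refl
carry-endB _ false refl = ↭-swap _ _ ↭-refl

carry-step : ∀ x y z w R → x ≢ y → y ≢ z → z ≢ w → 2 ≤ y → 2 ≤ z →
  carry x y z ++ gapChange x y z w ∷ R ↭ tripleSteps (x , y , z) ++ carry y z w ++ R
carry-step x y z w R x≢y y≢z z≢w (s≤s (s≤s _)) (s≤s (s≤s _)) =
  carry-stepB _ _ _ _ _ _ R (<ᵇ-flip x _ x≢y) (<ᵇ-flip _ _ y≢z) (<ᵇ-flip _ w z≢w)

gapChanges-telescope : ∀ x y ys → x ≢ y → 2 ≤ y → All (2 ≤_) ys → Linked _≢_ (y ∷ ys) →
  carry x y (head₀ ys) ++ gapChanges x y ys ↭ rdd⁺ ∷ concatMap tripleSteps (triples (x ∷ y ∷ ys ++ [ 0 ]))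
gapChanges-telescope x y [] x≢y (s≤s (s≤s _)) _ _ = carry-endB _ _ (<ᵇ-flip x _ x≢y)
gapChanges-telescope x y (z ∷ zs) x≢y 2≤y (2≤z ∷ 2≤zs) (y≢z ∷ linked) = begin
  carry x y z ++ gapChange x y z (head₀ zs) ∷ gapChanges y z zs
    ↭⟨ carry-step x y z (head₀ zs) _ x≢y y≢z (z≢head₀ zs 2≤z linked) 2≤y 2≤z ⟩
  tripleSteps (x , y , z) ++ carry y z (head₀ zs) ++ gapChanges y z zs
    ↭⟨ ↭P.++⁺ˡ (tripleSteps (x , y , z)) (gapChanges-telescope y z zs y≢z 2≤z 2≤zs linked) ⟩
  tripleSteps (x , y , z) ++ rdd⁺ ∷ concatMap tripleSteps (triples (y ∷ z ∷ zs ++ [ 0 ]))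
    ↭⟨ ↭P.shift rdd⁺ (tripleSteps (x , y , z)) _ ⟩
  rdd⁺ ∷ concatMap tripleSteps (triples (x ∷ y ∷ z ∷ zs ++ [ 0 ])) ∎
  where
  open PermutationReasoning
  z≢head₀ : ∀ zs → 2 ≤ z → Linked _≢_ (z ∷ zs) → z ≢ head₀ zs
  z≢head₀ [] (s≤s _) _ ()
  z≢head₀ (w ∷ ws) _ (z≢w ∷ _) = z≢w

interiorStepsOf : List Triple → List Stats
interiorStepsOf T = interiorSteps (count isValley T) (count isDoubleDescent T) (count isDoubleAscent T)

concatMap-stepIf : ∀ P δ T → concatMap (stepIf P δ) T ≡ replicate (count P T) δ
concatMap-stepIf P δ [] = refl
concatMap-stepIf P δ ((x , y , z) ∷ T) with P x y z
... | true = cong (δ ∷_) (concatMap-stepIf P δ T)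
... | false = concatMap-stepIf P δ T

concatMap-tripleSteps : ∀ T → concatMap tripleSteps T ↭ interiorStepsOf T
concatMap-tripleSteps T = begin
  concatMap tripleSteps T
    ↭⟨ concatMap-++-↭ (stepIf isValley rdd⁺) _ T ⟩
  concatMap (stepIf isValley rdd⁺) T ++ concatMap (λ t → stepIf isValley lda⁺ t ++ stepIf isDoubleDescent rdd⇒V t ++ stepIf isDoubleAscent lda⇒V t) T
    ↭⟨ ↭P.++⁺ˡ (concatMap (stepIf isValley rdd⁺) T) (concatMap-++-↭ (stepIf isValley lda⁺) _ T) ⟩
  concatMap (stepIf isValley rdd⁺) T ++ concatMap (stepIf isValley lda⁺) T ++ concatMap (λ t → stepIf isDoubleDescent rdd⇒V t ++ stepIf isDoubleAscent lda⇒V t) T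
    ↭⟨ ↭P.++⁺ˡ (concatMap (stepIf isValley rdd⁺) T) (↭P.++⁺ˡ (concatMap (stepIf isValley lda⁺) T) (concatMap-++-↭ (stepIf isDoubleDescent rdd⇒V) (stepIf isDoubleAscent lda⇒V) T)) ⟩
  concatMap (stepIf isValley rdd⁺) T ++ concatMap (stepIf isValley lda⁺) T ++ concatMap (stepIf isDoubleDescent rdd⇒V) T ++ concatMap (stepIf isDoubleAscent lda⇒V) T
    ≡⟨ cong₂ _++_ (concatMap-stepIf isValley rdd⁺ T) (cong₂ _++_ (concatMap-stepIf isValley lda⁺ T)
         (cong₂ _++_ (concatMap-stepIf isDoubleDescent rdd⇒V T) (concatMap-stepIf isDoubleAscent lda⇒V T))) ⟩
  interiorStepsOf T ∎
  where open PermutationReasoning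

innerGaps : ℕ → ℕ → List ℕ → List Stats
innerGaps x y [] = []
innerGaps x y (z ∷ zs) = gapChange x y z (head₀ zs) ∷ innerGaps y z zs

gapChanges≡innerGaps∷ʳ : ∀ x y ys → gapChanges x y ys ≡ innerGaps x y ys ∷ʳ rdd⁺
gapChanges≡innerGaps∷ʳ x y [] = refl
gapChanges≡innerGaps∷ʳ x y (z ∷ zs) = cong (gapChange x y z (head₀ zs) ∷_) (gapChanges≡innerGaps∷ʳ y z zs)

length-innerGaps : ∀ x y ys → length (innerGaps x y ys) ≡ length ys
length-innerGaps x y [] = refl
length-innerGaps x y (z ∷ zs) = cong suc (length-innerGaps y z zs)

innerGaps↭interiorSteps : ∀ y ys → 2 ≤ y → All (2 ≤_) ys → Linked _≢_ (y ∷ ys) → innerGaps 0 y ys ↭ interiorStepsOf (padTriples (y ∷ ys))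
innerGaps↭interiorSteps y ys 2≤y@(s≤s (s≤s _)) 2≤ys linked = ↭-trans (↭P.drop-∷ (begin
  rdd⁺ ∷ innerGaps 0 y ys                    ↭⟨ ↭P.∷↭∷ʳ rdd⁺ (innerGaps 0 y ys) ⟩
  innerGaps 0 y ys ∷ʳ rdd⁺                   ≡⟨ sym (gapChanges≡innerGaps∷ʳ 0 y ys) ⟩
  gapChanges 0 y ys                          ↭⟨ gapChanges-telescope 0 y ys (λ ()) 2≤y 2≤ys linked ⟩
  rdd⁺ ∷ concatMap tripleSteps (padTriples (y ∷ ys)) ∎))
  (concatMap-tripleSteps (padTriples (y ∷ ys)))
  where open PermutationReasoning

reverse-≢[] : ∀ {A : Set} {xs : List A} → xs ≢ [] → reverse xs ≢ []
reverse-≢[] {xs = xs} xs≢[] rev≡[] = xs≢[] (≡.trans (sym (LP.reverse-involutive xs)) (cong reverse rev≡[]))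

All-reverse : ∀ {A : Set} {P : A → Set} {xs} → All P xs → All P (reverse xs)
All-reverse {xs = xs} = ↭P.All-resp-↭ (↭-sym (↭P.↭-reverse xs))

map-suc-replicate : ∀ {A : Set} {f : A → ℕ} {n k} xs → map f xs ≡ replicate n k → map (suc ∘ f) xs ≡ replicate n (suc k)
map-suc-replicate {n = n} {k} xs fxs≡ = ≡.trans (LP.map-∘ xs) (≡.trans (cong (map suc) fxs≡) (LP.map-replicate suc n k))

LRmaxAux-insertions : ∀ c τ → All (2 ≤_) τ → map (LRmaxAux (suc c)) (insertions 1 τ) ≡ replicate (suc (length τ)) (LRmaxAux (suc c) τ)
LRmaxAux-insertions c [] _ = refl
LRmaxAux-insertions c (y ∷ ys) (s≤s (s≤s {n = y′} _) ∷ 2≤ys) =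
  cong (LRmaxAux (suc c) (y ∷ ys) ∷_) (≡.trans (sym (LP.map-∘ (insertions 1 ys))) (behind (suc c <ᵇ y)))
  where
  behind : ∀ b → map (λ τ → if b then suc (LRmaxAux y τ) else LRmaxAux (suc c) τ) (insertions 1 ys)
               ≡ replicate (suc (length ys)) (if b then suc (LRmaxAux y ys) else LRmaxAux (suc c) ys)
  behind true = map-suc-replicate (insertions 1 ys) (LRmaxAux-insertions (suc y′) ys 2≤ys)
  behind false = LRmaxAux-insertions c ys 2≤ys

LRmax-insertions : ∀ σ → σ ≢ [] → All (2 ≤_) σ → map LRmax (insertions 1 σ) ≡ suc (LRmax σ) ∷ replicate (length σ) (LRmax σ)
LRmax-insertions [] σ≢[] _ = ⊥-elim (σ≢[] refl)
LRmax-insertions (y ∷ ys) _ (s≤s (s≤s {n = y′} _) ∷ 2≤ys) = cong (suc (LRmax (y ∷ ys)) ∷_)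
  (≡.trans (sym (LP.map-∘ (insertions 1 ys))) (map-suc-replicate (insertions 1 ys) (LRmaxAux-insertions (suc y′) ys 2≤ys)))

insertions-∷ʳ : ∀ x τ y → insertions x (τ ∷ʳ y) ≡ map (_∷ʳ y) (insertions x τ) ∷ʳ (τ ∷ʳ y ∷ʳ x)
insertions-∷ʳ x [] y = refl
insertions-∷ʳ x (z ∷ zs) y = cong ((x ∷ z ∷ zs ∷ʳ y) ∷_) (begin
  map (z ∷_) (insertions x (zs ∷ʳ y))                                       ≡⟨ cong (map (z ∷_)) (insertions-∷ʳ x zs y) ⟩
  map (z ∷_) (map (_∷ʳ y) (insertions x zs) ∷ʳ (zs ∷ʳ y ∷ʳ x))             ≡⟨ LP.map-++ (z ∷_) (map (_∷ʳ y) (insertions x zs)) _ ⟩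
  map (z ∷_) (map (_∷ʳ y) (insertions x zs)) ∷ʳ (z ∷ zs ∷ʳ y ∷ʳ x)         ≡⟨ cong (_∷ʳ (z ∷ zs ∷ʳ y ∷ʳ x)) (sym (LP.map-∘ (insertions x zs))) ⟩
  map (λ τ → z ∷ τ ∷ʳ y) (insertions x zs) ∷ʳ (z ∷ zs ∷ʳ y ∷ʳ x)          ≡⟨ cong (_∷ʳ (z ∷ zs ∷ʳ y ∷ʳ x)) (LP.map-∘ (insertions x zs)) ⟩
  map (_∷ʳ y) (map (z ∷_) (insertions x zs)) ∷ʳ (z ∷ zs ∷ʳ y ∷ʳ x)         ∎)
  where open ≡.≡-Reasoning

map-reverse-insertions : ∀ x τ → map reverse (insertions x τ) ≡ reverse (insertions x (reverse τ))
map-reverse-insertions x [] = refl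
map-reverse-insertions x (y ∷ ys) = sym (begin
  reverse (insertions x (reverse (y ∷ ys)))
    ≡⟨ cong (reverse ∘ insertions x) (LP.unfold-reverse y ys) ⟩
  reverse (insertions x (reverse ys ∷ʳ y))
    ≡⟨ cong reverse (insertions-∷ʳ x (reverse ys) y) ⟩
  reverse (map (_∷ʳ y) (insertions x (reverse ys)) ∷ʳ (reverse ys ∷ʳ y ∷ʳ x))
    ≡⟨ LP.reverse-++ (map (_∷ʳ y) (insertions x (reverse ys))) _ ⟩
  (reverse ys ∷ʳ y ∷ʳ x) ∷ reverse (map (_∷ʳ y) (insertions x (reverse ys)))
    ≡⟨ cong₂ _∷_ (sym (≡.trans (LP.unfold-reverse x (y ∷ ys)) (cong (_∷ʳ x) (LP.unfold-reverse y ys))))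
                 (sym (LP.reverse-map (_∷ʳ y) (insertions x (reverse ys)))) ⟩
  reverse (x ∷ y ∷ ys) ∷ map (_∷ʳ y) (reverse (insertions x (reverse ys)))
    ≡⟨ cong (λ τs → reverse (x ∷ y ∷ ys) ∷ map (_∷ʳ y) τs) (sym (map-reverse-insertions x ys)) ⟩
  reverse (x ∷ y ∷ ys) ∷ map (_∷ʳ y) (map reverse (insertions x ys))
    ≡⟨ cong (reverse (x ∷ y ∷ ys) ∷_) (sym (LP.map-∘ (insertions x ys))) ⟩
  reverse (x ∷ y ∷ ys) ∷ map (λ τ → reverse τ ∷ʳ y) (insertions x ys)
    ≡⟨ cong (reverse (x ∷ y ∷ ys) ∷_) (LP.map-cong (λ τ → sym (LP.unfold-reverse y τ)) (insertions x ys)) ⟩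
  reverse (x ∷ y ∷ ys) ∷ map (reverse ∘ (y ∷_)) (insertions x ys)
    ≡⟨ cong (reverse (x ∷ y ∷ ys) ∷_) (LP.map-∘ (insertions x ys)) ⟩
  map reverse (insertions x (y ∷ ys)) ∎)
  where open ≡.≡-Reasoning

reverse-replicate : ∀ {A : Set} n (x : A) → reverse (replicate n x) ≡ replicate n x
reverse-replicate zero x = refl
reverse-replicate (suc n) x = ≡.trans (LP.unfold-reverse x (replicate n x)) (≡.trans (cong (_∷ʳ x) (reverse-replicate n x)) (replicate-∷ʳ n))
  where
  replicate-∷ʳ : ∀ n → replicate n x ∷ʳ x ≡ x ∷ replicate n x
  replicate-∷ʳ zero = refl
  replicate-∷ʳ (suc n) = cong (x ∷_) (replicate-∷ʳ n)

RLmax-insertions : ∀ σ → σ ≢ [] → All (2 ≤_) σ → map RLmax (insertions 1 σ) ≡ replicate (length σ) (RLmax σ) ∷ʳ suc (RLmax σ)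
RLmax-insertions σ σ≢[] 2≤σ = begin
  map (LRmax ∘ reverse) (insertions 1 σ)                       ≡⟨ LP.map-∘ (insertions 1 σ) ⟩
  map LRmax (map reverse (insertions 1 σ))                     ≡⟨ cong (map LRmax) (map-reverse-insertions 1 σ) ⟩
  map LRmax (reverse (insertions 1 (reverse σ)))               ≡⟨ LP.reverse-map LRmax (insertions 1 (reverse σ)) ⟩
  reverse (map LRmax (insertions 1 (reverse σ)))               ≡⟨ cong reverse (LRmax-insertions (reverse σ) (reverse-≢[] σ≢[]) (All-reverse 2≤σ)) ⟩
  reverse (suc R ∷ replicate (length (reverse σ)) R)           ≡⟨ LP.unfold-reverse (suc R) (replicate (length (reverse σ)) R) ⟩
  reverse (replicate (length (reverse σ)) R) ∷ʳ suc R          ≡⟨ cong (_∷ʳ suc R) (reverse-replicate _ R) ⟩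
  replicate (length (reverse σ)) R ∷ʳ suc R                    ≡⟨ cong (λ n → replicate n R ∷ʳ suc R) (LP.length-reverse σ) ⟩
  replicate (length σ) R ∷ʳ suc R                              ∎
  where
  open ≡.≡-Reasoning
  R = RLmax σ

LRmaxAux-map-suc : ∀ c τ → LRmaxAux (suc c) (map suc τ) ≡ LRmaxAux c τ
LRmaxAux-map-suc c [] = refl
LRmaxAux-map-suc c (x ∷ xs) with c <ᵇ x
... | true = cong suc (LRmaxAux-map-suc x xs)
... | false = LRmaxAux-map-suc c xs

LRmax-map-suc : ∀ σ → All (1 ≤_) σ → LRmax (map suc σ) ≡ LRmax σ
LRmax-map-suc [] _ = refl
LRmax-map-suc (zero ∷ _) (() ∷ _)
LRmax-map-suc (suc x ∷ xs) _ = cong suc (LRmaxAux-map-suc (suc x) xs)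

RLmax-map-suc : ∀ σ → All (1 ≤_) σ → RLmax (map suc σ) ≡ RLmax σ
RLmax-map-suc σ 1≤σ = ≡.trans (cong LRmax (sym (LP.reverse-map suc σ))) (LRmax-map-suc (reverse σ) (All-reverse 1≤σ))

zip3 : List Stats → List ℕ → List ℕ → List Item
zip3 (s ∷ ss) (l ∷ ls) (r ∷ rs) = (s , l , r) ∷ zip3 ss ls rs
zip3 _ _ _ = []

map≡zip3 : ∀ {A : Set} (f : A → Stats) (g h : A → ℕ) xs → map (λ x → f x , g x , h x) xs ≡ zip3 (map f xs) (map g xs) (map h xs)
map≡zip3 f g h [] = refl
map≡zip3 f g h (x ∷ xs) = cong (_ ∷_) (map≡zip3 f g h xs)

zip3-gaps : ∀ S L R Δ → zip3 (map (S ⊕_) (Δ ∷ʳ rdd⁺)) (replicate (suc (length Δ)) L) (replicate (length Δ) R ∷ʳ suc R)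
                        ≡ map (λ δ → S ⊕ δ , L , R) Δ ∷ʳ (S ⊕ rdd⁺ , L , suc R)
zip3-gaps S L R [] = refl
zip3-gaps S L R (δ ∷ Δ) = cong (_ ∷_) (zip3-gaps S L R Δ)

map-item-insertions : ∀ y ys → 2 ≤ y → All (2 ≤_) ys → Linked _≢_ (y ∷ ys) →
  map item (insertions 1 (y ∷ ys)) ↭ insertionItems (statsFrom 0 (y ∷ ys)) (LRmax (y ∷ ys)) (RLmax (y ∷ ys)) (interiorStepsOf (padTriples (y ∷ ys)))
map-item-insertions y ys 2≤y@(s≤s (s≤s _)) 2≤ys linked = begin
  map item (insertions 1 τ)
    ≡⟨ map≡zip3 (statsFrom 0) LRmax RLmax (insertions 1 τ) ⟩
  zip3 (map (statsFrom 0) (insertions 1 τ)) (map LRmax (insertions 1 τ)) (map RLmax (insertions 1 τ))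
    ≡⟨ cong₂ (λ ss rs → zip3 ss (map LRmax (insertions 1 τ)) rs) stats-insertions (RLmax-insertions τ (λ ()) (2≤y ∷ 2≤ys)) ⟩
  zip3 ((S ⊕ lda⁺) ∷ map (S ⊕_) (Δ ∷ʳ rdd⁺)) (map LRmax (insertions 1 τ)) (replicate (length τ) R ∷ʳ suc R)
    ≡⟨ cong (λ ls → zip3 ((S ⊕ lda⁺) ∷ map (S ⊕_) (Δ ∷ʳ rdd⁺)) ls (replicate (length τ) R ∷ʳ suc R)) (LRmax-insertions τ (λ ()) (2≤y ∷ 2≤ys)) ⟩
  zip3 ((S ⊕ lda⁺) ∷ map (S ⊕_) (Δ ∷ʳ rdd⁺)) (suc L ∷ replicate (length τ) L) (replicate (length τ) R ∷ʳ suc R)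
    ≡⟨ cong (λ n → zip3 ((S ⊕ lda⁺) ∷ map (S ⊕_) (Δ ∷ʳ rdd⁺)) (suc L ∷ replicate (suc n) L) (replicate (suc n) R ∷ʳ suc R)) (sym (length-innerGaps 0 y ys)) ⟩
  (S ⊕ lda⁺ , suc L , R) ∷ zip3 (map (S ⊕_) (Δ ∷ʳ rdd⁺)) (replicate (suc (length Δ)) L) (replicate (length Δ) R ∷ʳ suc R)
    ≡⟨ cong ((S ⊕ lda⁺ , suc L , R) ∷_) (zip3-gaps S L R Δ) ⟩
  (S ⊕ lda⁺ , suc L , R) ∷ (map (λ δ → S ⊕ δ , L , R) Δ ∷ʳ (S ⊕ rdd⁺ , L , suc R))
    ↭⟨ ↭-prep _ (↭-sym (↭P.∷↭∷ʳ _ _)) ⟩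
  insertionItems S L R Δ
    ↭⟨ ↭-prep _ (↭-prep _ (↭P.map⁺ _ (innerGaps↭interiorSteps y ys 2≤y 2≤ys linked))) ⟩
  insertionItems S L R (interiorStepsOf (padTriples τ)) ∎
  where
  open PermutationReasoning
  τ = y ∷ ys
  S = statsFrom 0 τ
  L = LRmax τ
  R = RLmax τ
  Δ = innerGaps 0 y ys
  stats-insertions : map (statsFrom 0) (insertions 1 τ) ≡ (S ⊕ lda⁺) ∷ map (S ⊕_) (Δ ∷ʳ rdd⁺)
  stats-insertions = cong₂ _∷_
    (≡.trans (⊕-comm lda⁺ (statsFrom 1 τ)) (cong (_⊕ lda⁺) (sym (statsFrom-0≡1 y ys 2≤y))))
    (≡.trans (sym (LP.map-∘ (insertions 1 ys)))
    (≡.trans (statsFrom-insertions 0 y ys 2≤y 2≤ys) (cong (map (S ⊕_)) (gapChanges≡innerGaps∷ʳ 0 y ys))))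

interiorStepsOf-cong : ∀ T T′ → statsOf T ≡ statsOf T′ → interiorStepsOf T ≡ interiorStepsOf T′
interiorStepsOf-cong T T′ T≡T′ with stats-injective (≡.trans (sym (statsOf≡counts T)) (≡.trans T≡T′ (statsOf≡counts T′)))
... | v≡ , r≡ , d≡ = ≡.cong₂ (λ v (r , d) → interiorSteps v r d) (ℤP.+-injective v≡) (≡.cong₂ _,_ (ℤP.+-injective r≡) (ℤP.+-injective d≡))

map-item-insertOne : ∀ σ → Shaped σ →
  map item (insertOne σ) ↭ insertionItems (statsFrom 0 σ) (LRmax σ) (RLmax σ) (interiorStepsOf (padTriples σ))
map-item-insertOne [] (σ≢[] , _ , _) = ⊥-elim (σ≢[] refl)
map-item-insertOne σ@(y ∷ ys) (_ , 1≤σ@(1≤y ∷ 1≤ys) , linked) =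
  ↭-trans (map-item-insertions (suc y) (map suc ys) (s≤s 1≤y) (All-map-suc ys 1≤ys) (Linked-map-suc linked))
  (↭-reflexive (≡.cong₂ (λ (S , X) (L , R) → insertionItems S L R X)
    (≡.cong₂ _,_ stats-shift (interiorStepsOf-cong (padTriples (map suc σ)) (padTriples σ) stats-shift))
    (≡.cong₂ _,_ (LRmax-map-suc σ 1≤σ) (RLmax-map-suc σ 1≤σ))))
  where
  stats-shift : statsFrom 0 (map suc σ) ≡ statsFrom 0 σ
  stats-shift = statsFrom-map-suc σ 1≤σ

abWeight : List ℕ → ℤ × Mono
abWeight σ = 1ℤ , (1ℤ ∷ 1ℤ ∷ + V σ ∷ + (W σ ∸ 1) ∷ + rdd σ ∷ + lda σ ∷ []) , LRmax σ ∸ 1 , RLmax σ ∸ 1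

ab*P-map-weight : ∀ σs → (a *P b) *P map weight σs ≡ map abWeight σs ++ []
ab*P-map-weight [] = refl
ab*P-map-weight (σ ∷ σs) = cong (abWeight σ ∷_) (ab*P-map-weight σs)

abWeight≡term-item : ∀ σ → Shaped σ → abWeight σ ≡ term (item σ)
abWeight≡term-item σ sh
  rewrite statsOf≡counts (padTriples σ) | W≡suc-V σ sh
        | countT≡count isValley σ | countT≡count isDoubleDescent σ | countT≡count isDoubleAscent σ = refl

LRmax-positive : ∀ τ → τ ≢ [] → All (1 ≤_) τ → LRmax τ ≡ suc (LRmax τ ∸ 1)
LRmax-positive [] τ≢[] _ = ⊥-elim (τ≢[] refl)
LRmax-positive (zero ∷ _) _ (() ∷ _)
LRmax-positive (suc x ∷ xs) _ _ = refl

item-shape : ∀ σ → Shaped σ → let T = padTriples σ in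
  item σ ≡ (stats (+ count isValley T) (+ count isDoubleDescent T) (+ count isDoubleAscent T) , suc (LRmax σ ∸ 1) , suc (RLmax σ ∸ 1))
item-shape σ (σ≢[] , 1≤σ , _) = ≡.cong₂ _,_ (statsOf≡counts (padTriples σ))
  (≡.cong₂ _,_ (LRmax-positive σ σ≢[] 1≤σ) (LRmax-positive (reverse σ) (reverse-≢[] σ≢[]) (All-reverse 1≤σ)))

Dterm-abWeight : ∀ σ → Shaped σ → Dterm (abWeight σ) ≈P map abWeight (insertOne σ)
Dterm-abWeight σ sh = begin
  Dterm (abWeight σ)
    ≡⟨ cong Dterm (≡.trans (abWeight≡term-item σ sh) (cong term (item-shape σ sh))) ⟩
  Dterm (term (stats (+ v) (+ r) (+ d) , suc i , suc j))
    ≈⟨ Dterm-term v r d i j ⟩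
  map term (insertionItems (stats (+ v) (+ r) (+ d)) (suc i) (suc j) (interiorSteps v r d))
    ≡⟨ cong (λ (S , L , R) → map term (insertionItems S L R (interiorSteps v r d))) (sym (item-shape σ sh)) ⟩
  map term (insertionItems (statsFrom 0 σ) (LRmax σ) (RLmax σ) (interiorStepsOf (padTriples σ)))
    ≈⟨ ↭⇒≈P (↭P.map⁺ term (↭-sym (map-item-insertOne σ sh))) ⟩
  map term (map item (insertOne σ))
    ≡⟨ sym (LP.map-∘ (insertOne σ)) ⟩
  map (term ∘ item) (insertOne σ)
    ≡⟨ sym (LP.map-cong-local (All.map (λ {τ} → abWeight≡term-item τ) (Shaped-insertOne σ sh))) ⟩
  map abWeight (insertOne σ) ∎
  where
  open ≈P-Reasoning
  v = count isValley (padTriples σ)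
  r = count isDoubleDescent (padTriples σ)
  d = count isDoubleAscent (padTriples σ)
  i = LRmax σ ∸ 1
  j = RLmax σ ∸ 1

iter-D-ab≈perms : ∀ n → iter D n (a *P b) ≈P map abWeight (perms (suc n))
iter-D-ab≈perms zero _ = refl
iter-D-ab≈perms (suc n) = begin
  D (iter D n (a *P b))                        ≈⟨ D-cong {iter D n (a *P b)} {map abWeight σs} (iter-D-ab≈perms n) ⟩
  D (map abWeight σs)                          ≡⟨ LP.concatMap-map Dterm abWeight σs ⟩
  concatMap (Dterm ∘ abWeight) σs              ≈⟨ concatMap-cong≈P _ _ σs (All.map (λ {σ} → Dterm-abWeight σ) (Shaped-perms n)) ⟩
  concatMap (map abWeight ∘ insertOne) σs      ≡⟨ sym (LP.map-concatMap abWeight insertOne σs) ⟩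
  map abWeight (concatMap insertOne σs)        ≈⟨ ↭⇒≈P (↭P.map⁺ abWeight (perms-insertOne (suc n))) ⟩
  map abWeight (perms (suc (suc n)))           ∎
  where
  open ≈P-Reasoning
  σs = perms (suc n)

mainTheorem18 : (n : ℕ) → iter D n (a *P b) ≈P ((a *P b) *P P n)
mainTheorem18 n = begin
  iter D n (a *P b)                  ≈⟨ iter-D-ab≈perms n ⟩
  map abWeight (perms (suc n))       ≡⟨ sym (LP.++-identityʳ _) ⟩
  map abWeight (perms (suc n)) ++ [] ≡⟨ sym (ab*P-map-weight (perms (suc n))) ⟩
  (a *P b) *P P n                    ∎
  where open ≈P-Reasoning
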